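{- Let $A\in\mathbb{Z}^{m\times n}$ be an integer matrix, let $A_B\in\mathbb{Z}^{m\times q}$ be its bouquet matrix, and let $T:\operatorname{Ker}_{\mathbb{Z}}(A)\to\operatorname{Ker}_{\mathbb{Z}}(A_B)$ be the isomorphism described in the context. If $\{\mathbf{u}_1,\ldots,\mathbf{u}_t\}$ is a minimal Markov basis of $A$, then $\{T(\mathbf{u}_1),\ldots,T(\mathbf{u}_t)\}$ is a Markov basis of $A_B$ (not necessarily minimal).
   Context: For an integer matrix $M$ with $N$ columns, a Markov basis of $M$ is a finite set $\mathcal{M}\subseteq\operatorname{Ker}_{\mathbb{Z}}(M)$ such that whenever $\mathbf{w},\mathbf{u}\in\mathbb{N}^N$ with $\mathbf{w}-\mathbf{u}\in\operatorname{Ker}_{\mathbb{Z}}(M)$, there exist $\mathbf{v}_1,\ldots,\mathbf{v}_p\in\mathcal{M}\cup(-\mathcal{M})$ with $\mathbf{w}-\sum_{i=1}^l\mathbf{v}_i\in\mathbb{N}^N$ for all $1\le l\le p$ and $\mathbf{w}-\mathbf{u}=\sum_{i=1}^p\mathbf{v}_i$. It is minimal if no proper subset is a Markov basis. Bouquets. Let $A=[\mathbf{a}_1,\ldots,\mathbf{a}_n]\in\mathbb{Z}^{m\times n}$. Fix a matrix whose columns form a $\mathbb{Z}$-basis of $\operatorname{Ker}_{\mathbb{Z}}(A)$, and let the Gale transform $G(\mathbf{a}_i)$ be its $i$-th row. Call $i\neq j$ adjacent if there is $\mathbf{v}\in\mathbb{Z}^m$ such that $\mathbf{v}\cdot A$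 has nonzero entries exactly in positions $i$ and $j$; the bouquets of $A$ are the classes of the equivalence relation on the columns generated by adjacency. A bouquet is free if $G(\mathbf{a}_i)=\mathbf{0}$ for its columns (equivalently, $i$ lies outside the support of every element of $\operatorname{Ker}_{\mathbb{Z}}(A)$); otherwise it is non-free, and then all $G(\mathbf{a}_i)$, $\mathbf{a}_i\in B$, are nonzero and pairwise linearly dependent. For each bouquet $B$ define $\mathbf{c}_B\in\mathbb{Z}^n$: if $B$ is free, $\mathbf{c}_B$ is any nonzero vector with support $\{i:\mathbf{a}_i\in B\}$ whose first nonzero coordinate is positive; if $B$ is non-free, pick a coordinate $j$ with $G(\mathbf{a}_i)_j\neq0$ for all $\mathbf{a}_i\in B$, let $g=\gcd(G(\mathbf{a}_i)_j:\mathbf{a}_i\in B)$, let $i_0$ be the smallest index with $\mathbf{a}_{i_0}\in B$, let $\varepsilon$ be the sign of $G(\mathbf{a}_{i_0})_j$, and set $(\mathbf{c}_B)_i=\varepsilon G(\mathbf{a}_i)_j/g$ if $\mathbf{a}_i\in B$ and $0$ otherwise. Set $\mathbf{a}_B=\sum_{i=1}^n(\mathbf{c}_B)_i\mathbf{a}_i\in\mathbb{Z}^m$. If $B_1,\ldots,B_q$ are the bouquets of $A$, the bouquet matrix is $A_B=[\mathbf{a}_{B_1},\ldots,\mathbf{a}_{B_q}]\in\mathbb{Z}^{m\times q}$. Let $j_k=\min\operatorname{supp}(\mathbf{c}_{B_k})$, so $(\mathbf{c}_{B_k})_{j_k}>0$. The map $D:\operatorname{Ker}_{\mathbb{Z}}(A_B)\to\operatorname{Ker}_{\mathbb{Z}}(A)$,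 $D(u_1,\ldots,u_q)=\sum_k u_k\mathbf{c}_{B_k}$, is a (known) isomorphism, and its inverse $T$ is given by $T(\mathbf{v})=(v_{j_1}/(\mathbf{c}_{B_1})_{j_1},\ldots,v_{j_q}/(\mathbf{c}_{B_q})_{j_q})$. -}

module Defs where

open import Data.Nat as ℕ using (ℕ; zero; suc)
open import Data.Nat.GCD using (gcd)
open import Data.Integer as ℤ using (ℤ; +_; +0; +[1+_]; -[1+_]; _+_; _*_; -_; _-_; ∣_∣)
open import Data.Integer.DivMod using (_/_)
open import Data.Fin using (Fin; zero; suc; toℕ)
open import Data.List using (List)
open import Data.List.Relation.Unary.Any using (Any)
open import Data.List.Relation.Unary.All using (All)
open import Data.Product using (Σ; ∃; _×_; _,_)
open import Data.Sum using (_⊎_)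
open import Data.Bool using (if_then_else_)
open import Relation.Nullary using (¬_; Dec; yes; no)
open import Relation.Nullary.Decidable using (⌊_⌋)
open import Relation.Binary.PropositionalEquality using (_≡_; _≢_; _≗_)
open import Relation.Binary.Construct.Closure.Equivalence using (EqClosure)
open import Function.Bundles using (_⇔_)
import Data.Fin as F

Vecℤ : ℕ → Set
Vecℤ n = Fin n → ℤ

Matrix : ℕ → ℕ → Set
Matrix m n = Fin m → Fin n → ℤ

sumFin : ∀ n → (Fin n → ℤ) → ℤ
sumFin zero    f = +0
sumFin (suc n) f = f zero + sumFin n (λ i → f (suc i))

-- gcd_{i < n} f i  (gcd of the empty family is 0; gcd(0,x) = x)
gcdFin : ∀ n → (Fin n → ℕ) → ℕ
gcdFin zero    f = 0
gcdFin (suc n) f = gcd (f zero) (gcdFin n (λ i → f (suc i)))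

mulVec : ∀ {m n} → Matrix m n → Vecℤ n → Vecℤ m
mulVec M u i = sumFin _ (λ j → M i j * u j)

vecMul : ∀ {m n} → Vecℤ m → Matrix m n → Vecℤ n
vecMul v M j = sumFin _ (λ i → v i * M i j)

zeroV : ∀ {n} → Vecℤ n
zeroV _ = +0

negV : ∀ {n} → Vecℤ n → Vecℤ n
negV u i = - u i

subV : ∀ {n} → Vecℤ n → Vecℤ n → Vecℤ n
subV u v i = u i - v i

InKer : ∀ {m n} → Matrix m n → Vecℤ n → Set
InKer M u = mulVec M u ≗ zeroV

NonNeg : ∀ {n} → Vecℤ n → Set
NonNeg u = ∀ i → +0 ℤ.≤ u i

-- Markov bases (a finite set is given as a list of vectors)

_∈V_ : ∀ {n} → Vecℤ n → List (Vecℤ n) → Set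
v ∈V L = Any (λ x → v ≗ x) L

_∈±_ : ∀ {n} → Vecℤ n → List (Vecℤ n) → Set
v ∈± L = v ∈V L ⊎ negV v ∈V L

-- Moves w → u: a sequence v₁,…,v_p ∈ 𝓜 ∪ (−𝓜) with every
-- w − Σ_{i ≤ l} vᵢ ∈ ℕ^N (1 ≤ l ≤ p) and w − u = Σ_{i ≤ p} vᵢ.
data Moves {n} (L : List (Vecℤ n)) : Vecℤ n → Vecℤ n → Set where
  done : ∀ {w u} → w ≗ u → Moves L w u
  step : ∀ {w u} (v : Vecℤ n) → v ∈± L → NonNeg (subV w v) →
         Moves L (subV w v) u → Moves L w u

MarkovBasis : ∀ {m n} → Matrix m n → List (Vecℤ n) → Set
MarkovBasis {n = n} M L =
  All (InKer M) L ×
  (∀ (w u : Vecℤ n) → NonNeg w → NonNeg u → InKer M (subV w u) → Moves L w u)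

MinimalMarkovBasis : ∀ {m n} → Matrix m n → List (Vecℤ n) → Set
MinimalMarkovBasis {n = n} M L =
  MarkovBasis M L ×
  (∀ (L′ : List (Vecℤ n)) → (∀ x → x ∈V L′ → x ∈V L) →
     (∃ λ x → x ∈V L × ¬ (x ∈V L′)) → ¬ MarkovBasis M L′)

-- Gale transform: the columns of K (n × r) form a ℤ-basis of Ker_ℤ(A);
-- G(a_i) is the i-th row of K.

IsKernelBasis : ∀ {m n r} → Matrix m n → Matrix n r → Set
IsKernelBasis {r = r} A K =
  (∀ (c : Fin r) → InKer A (λ i → K i c)) ×
  (∀ u → InKer A u → ∃ λ (l : Vecℤ r) → u ≗ mulVec K l) ×
  (∀ (l : Vecℤ r) → mulVec K l ≗ zeroV → l ≗ zeroV)

Adjacent : ∀ {m n} → Matrix m n → Fin n → Fin n → Set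
Adjacent {m} A i j =
  i ≢ j × ∃ λ (v : Vecℤ m) → ∀ k → (vecMul v A k ≢ +0) ⇔ (k ≡ i ⊎ k ≡ j)

SameBouquet : ∀ {m n} → Matrix m n → Fin n → Fin n → Set
SameBouquet A = EqClosure (Adjacent A)

-- total integer division (exact in all uses below; divisor ≠ 0 there)
_divℤ_ : ℤ → ℤ → ℤ
a divℤ +0         = +0
a divℤ +[1+ b ]   = a / +[1+ b ]
a divℤ -[1+ b ]   = a / -[1+ b ]

sgn : ℤ → ℤ
sgn +0        = +0
sgn +[1+ _ ]  = + 1
sgn -[1+ _ ]  = -[1+ 0 ]

-- A choice of bouquet data for A (w.r.t. the fixed Gale transform K):
-- an enumeration B₁,…,B_q of the bouquets (via β : column ↦ bouquet index)
-- and the vectors c_{B_k}, with j_k = min supp(c_{B_k}).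
record BouquetData {m n r} (A : Matrix m n) (K : Matrix n r) : Set where
  field
    q      : ℕ
    β      : Fin n → Fin q
    β-onto : ∀ k → ∃ λ i → β i ≡ k
    β-cls  : ∀ i j → (β i ≡ β j) ⇔ SameBouquet A i j

  InB : Fin q → Fin n → Set
  InB k i = β i ≡ k

  Free : Fin q → Set
  Free k = ∀ i → InB k i → ∀ c → K i c ≡ +0

  field
    c      : Fin q → Vecℤ n
    c-free : ∀ k → Free k →
               (∀ i → (c k i ≢ +0) ⇔ InB k i) ×
               (∃ λ i₀ → (+0 ℤ.< c k i₀) × (∀ i → toℕ i ℕ.< toℕ i₀ → c k i ≡ +0))
    -- non-free bouquet: (c_B)_i = ε G(a_i)_j / g on B, 0 outside
    c-nonfree : ∀ k → ¬ Free k →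
               ∃ λ (j : Fin r) → (∀ i → InB k i → K i j ≢ +0) ×
               ∃ λ i₀ → InB k i₀ × (∀ i → InB k i → toℕ i₀ ℕ.≤ toℕ i) ×
               (∀ i → c k i ≡
                  (if ⌊ β i F.≟ k ⌋
                   then (sgn (K i₀ j) * K i j) divℤ
                        (+ gcdFin n (λ i′ → if ⌊ β i′ F.≟ k ⌋ then ∣ K i′ j ∣ else 0))
                   else +0))
    jk     : Fin q → Fin n
    jk-supp : ∀ k → c k (jk k) ≢ +0
    jk-min  : ∀ k i → toℕ i ℕ.< toℕ (jk k) → c k i ≡ +0

  A_B : Matrix m q
  A_B l k = sumFin n (λ i → c k i * A l i)

  T : Vecℤ n → Vecℤ q
  T v k = v (jk k) divℤ c k (jk k)

-- Two columns in one bouquet are coupled: every kernel vector of A takes proportional values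
-- on them. On a free bouquet kernel vectors vanish; on a non-free one they are proportional
-- to a Gale column, hence to c_B, and the gcd normalisation of c_B makes the factor the
-- integer T v. So v = D (T v) for v ∈ Ker A, and A_B y = A (D y). Given w, u ∈ ℕ^q with
-- w − u ∈ Ker A_B, splitting D (w − u) by the signs of the c_B gives W, U ∈ ℕ^n with
-- W − U = D (w − u). A move sequence of the Markov basis from W to U, read at the
-- coordinates j_k (where c_B is positive) and divided by (c_B)_{j_k}, is a move sequence of
-- its image under T from w to u.
module Submission where

open import Defs
open import Data.Nat as ℕ using (ℕ; zero; suc)
import Data.Nat.Properties as ℕₚ
open import Data.Nat.Divisibility as ℕ∣ using (divides) renaming (_∣_ to _∣ℕ_)
open import Data.Nat.GCD using (gcd; gcd[m,n]∣m; gcd[m,n]∣n; gcd-greatest; c*gcd[m,n]≡gcd[cm,cn])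
open import Data.Integer as ℤ using (ℤ; +_; +0; +[1+_]; -[1+_]; _+_; _*_; -_; _-_; ∣_∣; _<_; _≤_)
open import Data.Integer.Properties
open import Data.Integer.Divisibility using (_∣_)
open import Data.Integer.DivMod using (a≡a%n+[a/n]*n)
open import Data.Integer.Tactic.RingSolver using (solve-∀)
open import Data.Fin as Fin using (Fin; zero; suc; toℕ)
import Data.Fin.Properties as Finₚ
open import Data.List using (List; map)
import Data.List.Relation.Unary.Any as Any
import Data.List.Relation.Unary.Any.Properties as Anyₚ
open import Data.List.Relation.Unary.All as All using (All)
import Data.List.Relation.Unary.All.Properties as Allₚ
open import Data.Product using (∃; ∃₂; _×_; _,_; proj₁; proj₂)
open import Data.Sum using (_⊎_; inj₁; inj₂; [_,_]′)
open import Data.Bool using (if_then_else_)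
open import Function using (_∘_)
open import Relation.Nullary using (¬_; Dec; yes; no; contradiction)
open import Relation.Nullary.Decidable using (⌊_⌋; _→-dec_; decidable-stable)
open import Relation.Binary.PropositionalEquality
open import Relation.Binary.Definitions using (tri<; tri≈; tri>)
open import Relation.Binary.Structures using (IsEquivalence)
open import Relation.Binary.Construct.Closure.Equivalence using (fold)
open import Function.Bundles using (Equivalence)

open ≡-Reasoning

sumFin-cong : ∀ n {f g : Fin n → ℤ} → f ≗ g → sumFin n f ≡ sumFin n g
sumFin-cong zero    f≗g = refl
sumFin-cong (suc n) f≗g = cong₂ _+_ (f≗g zero) (sumFin-cong n (f≗g ∘ suc))

sumFin-+ : ∀ n (f g : Fin n → ℤ) → sumFin n (λ i → f i + g i) ≡ sumFin n f + sumFin n g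
sumFin-+ zero    f g = refl
sumFin-+ (suc n) f g = begin
  (f zero + g zero) + sumFin n (λ i → f (suc i) + g (suc i))
    ≡⟨ cong (_+_ (f zero + g zero)) (sumFin-+ n (f ∘ suc) (g ∘ suc)) ⟩
  (f zero + g zero) + (sumFin n (f ∘ suc) + sumFin n (g ∘ suc))
    ≡⟨ interchange (f zero) (g zero) _ _ ⟩
  (f zero + sumFin n (f ∘ suc)) + (g zero + sumFin n (g ∘ suc)) ∎
  where
  interchange : ∀ a b c d → (a + b) + (c + d) ≡ (a + c) + (b + d)
  interchange = solve-∀

sumFin-*ˡ : ∀ n a (f : Fin n → ℤ) → sumFin n (λ i → a * f i) ≡ a * sumFin n f
sumFin-*ˡ zero    a f = sym (*-zeroʳ a)
sumFin-*ˡ (suc n) a f =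
  trans (cong (_+_ (a * f zero)) (sumFin-*ˡ n a (f ∘ suc))) (sym (*-distribˡ-+ a _ _))

sumFin-*ʳ : ∀ n a (f : Fin n → ℤ) → sumFin n (λ i → f i * a) ≡ sumFin n f * a
sumFin-*ʳ n a f = begin
  sumFin n (λ i → f i * a) ≡⟨ sumFin-cong n (λ i → *-comm (f i) a) ⟩
  sumFin n (λ i → a * f i) ≡⟨ sumFin-*ˡ n a f ⟩
  a * sumFin n f           ≡⟨ *-comm a _ ⟩
  sumFin n f * a           ∎

sumFin-zero : ∀ n {f : Fin n → ℤ} → (∀ i → f i ≡ +0) → sumFin n f ≡ +0
sumFin-zero zero    f≡0 = refl
sumFin-zero (suc n) f≡0 = cong₂ _+_ (f≡0 zero) (sumFin-zero n (f≡0 ∘ suc))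

suc-≢ : ∀ {n} {i j : Fin n} → i ≢ j → Fin.suc i ≢ suc j
suc-≢ i≢j = i≢j ∘ Finₚ.suc-injective

sumFin-single : ∀ n (f : Fin n → ℤ) j → (∀ i → i ≢ j → f i ≡ +0) → sumFin n f ≡ f j
sumFin-single (suc n) f zero    f≡0 =
  trans (cong (_+_ (f zero)) (sumFin-zero n (λ i → f≡0 (suc i) λ ()))) (+-identityʳ _)
sumFin-single (suc n) f (suc j) f≡0 =
  trans (cong₂ _+_ (f≡0 zero λ ()) (sumFin-single n (f ∘ suc) j (λ i → f≡0 (suc i) ∘ suc-≢)))
        (+-identityˡ _)

sumFin-pair : ∀ n (f : Fin n → ℤ) i j → i ≢ j → (∀ k → k ≢ i → k ≢ j → f k ≡ +0) →
              sumFin n f ≡ f i + f j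
sumFin-pair (suc n) f zero    zero    i≢j f≡0 = contradiction refl i≢j
sumFin-pair (suc n) f zero    (suc j) i≢j f≡0 =
  cong (_+_ (f zero)) (sumFin-single n (f ∘ suc) j (λ k → f≡0 (suc k) (λ ()) ∘ suc-≢))
sumFin-pair (suc n) f (suc i) zero    i≢j f≡0 =
  trans (cong (_+_ (f zero)) (sumFin-single n (f ∘ suc) i (λ k k≢i → f≡0 (suc k) (suc-≢ k≢i) λ ())))
        (+-comm (f zero) (f (suc i)))
sumFin-pair (suc n) f (suc i) (suc j) i≢j f≡0 =
  trans (cong₂ _+_ (f≡0 zero (λ ()) (λ ()))
                   (sumFin-pair n (f ∘ suc) i j (i≢j ∘ cong suc)
                                (λ k k≢i k≢j → f≡0 (suc k) (suc-≢ k≢i) (suc-≢ k≢j))))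
        (+-identityˡ _)

sumFin-swap : ∀ n m (f : Fin n → Fin m → ℤ) →
              sumFin n (λ i → sumFin m (f i)) ≡ sumFin m (λ j → sumFin n (λ i → f i j))
sumFin-swap zero    m f = sym (sumFin-zero m λ _ → refl)
sumFin-swap (suc n) m f =
  trans (cong (_+_ (sumFin m (f zero))) (sumFin-swap n m (f ∘ suc)))
        (sym (sumFin-+ m (f zero) _))

*-cancelʳ-≢0 : ∀ {i j k} → k ≢ +0 → i * k ≡ j * k → i ≡ j
*-cancelʳ-≢0 {i} {j} {k} k≢0 = *-cancelʳ-≡ i j k {{ℤ.≢-nonZero k≢0}}

%ℕ-divisible : ∀ a d .{{_ : ℕ.NonZero d}} → d ∣ℕ ∣ a ∣ → a ℤ.%ℕ d ≡ 0
%ℕ-divisible (+ n)    d d∣a = ℕ∣.n∣m⇒m%n≡0 n d d∣a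
%ℕ-divisible -[1+ n ] d d∣a with suc n ℕ.% d | ℕ∣.n∣m⇒m%n≡0 (suc n) d d∣a
... | zero | _ = refl

/-exact : ∀ a d .{{_ : ℤ.NonZero d}} → d ∣ a → (a ℤ./ d) * d ≡ a
/-exact a d d∣a = sym (begin
  a                          ≡⟨ a≡a%n+[a/n]*n a d ⟩
  + (a ℤ.% d) + (a ℤ./ d) * d ≡⟨ cong (λ r → + r + (a ℤ./ d) * d) (%ℕ-divisible a ∣ d ∣ d∣a) ⟩
  +0 + (a ℤ./ d) * d          ≡⟨ +-identityˡ _ ⟩
  (a ℤ./ d) * d              ∎)

divℤ-exact : ∀ {a d} → d ≢ +0 → d ∣ a → (a divℤ d) * d ≡ a
divℤ-exact {a} {+0}       d≢0 d∣a = contradiction refl d≢0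
divℤ-exact {a} {+[1+ b ]} d≢0 d∣a = /-exact a +[1+ b ] d∣a
divℤ-exact {a} { -[1+ b ]} d≢0 d∣a = /-exact a -[1+ b ] d∣a

divℤ-cancel : ∀ t {d} → d ≢ +0 → (t * d) divℤ d ≡ t
divℤ-cancel t {d} d≢0 =
  *-cancelʳ-≢0 d≢0 (divℤ-exact d≢0 (subst (∣ d ∣ ∣ℕ_) (sym (abs-* t d)) (ℕ∣.n∣m*n ∣ t ∣)))

*-≢0 : ∀ {a b} → a ≢ +0 → b ≢ +0 → a * b ≢ +0
*-≢0 {a} a≢0 b≢0 ab≡0 with i*j≡0⇒i≡0∨j≡0 a ab≡0
... | inj₁ a≡0 = a≢0 a≡0
... | inj₂ b≡0 = b≢0 b≡0

sgn-*-self : ∀ x → sgn x * x ≡ + ∣ x ∣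
sgn-*-self +0        = refl
sgn-*-self +[1+ n ]  = *-identityˡ +[1+ n ]
sgn-*-self -[1+ n ]  = -1*i≡-i -[1+ n ]

∣sgn∣≡1 : ∀ {x} → x ≢ +0 → ∣ sgn x ∣ ≡ 1
∣sgn∣≡1 {+0}       x≢0 = contradiction refl x≢0
∣sgn∣≡1 {+[1+ _ ]} x≢0 = refl
∣sgn∣≡1 { -[1+ _ ]} x≢0 = refl

nonNeg-cancelʳ : ∀ {a d} → +0 < d → +0 ≤ a * d → +0 ≤ a
nonNeg-cancelʳ {a} {d} d>0 = *-cancelʳ-≤-pos +0 a d {{ℤ.positive d>0}}

splitScale : ℤ → ℤ → ℤ → ℤ
splitScale (+ k)    a b = a * + k
splitScale -[1+ k ] a b = b * +[1+ k ]

splitScale-nonNeg : ∀ x {a b} → +0 ≤ a → +0 ≤ b → +0 ≤ splitScale x a b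
splitScale-nonNeg (+ k)    a≥0 b≥0 = *-monoʳ-≤-nonNeg (+ k) a≥0
splitScale-nonNeg -[1+ k ] a≥0 b≥0 = *-monoʳ-≤-nonNeg +[1+ k ] b≥0

splitScale-sub : ∀ x a b → splitScale x a b - splitScale x b a ≡ (a - b) * x
splitScale-sub (+ k)    a b = distrib (+ k) a b
  where
  distrib : ∀ k a b → a * k - b * k ≡ (a - b) * k
  distrib = solve-∀
splitScale-sub -[1+ k ] a b = distrib +[1+ k ] a b
  where
  distrib : ∀ k a b → b * k - a * k ≡ (a - b) * (- k)
  distrib = solve-∀

splitScale-pos : ∀ {x} a b → +0 < x → splitScale x a b ≡ a * x
splitScale-pos {+0}       a b (ℤ.+<+ ())
splitScale-pos {+[1+ _ ]} a b _ = refl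

gcdFin-∣ : ∀ n (h : Fin n → ℕ) i → gcdFin n h ∣ℕ h i
gcdFin-∣ (suc n) h zero    = gcd[m,n]∣m _ _
gcdFin-∣ (suc n) h (suc i) = ℕ∣.∣-trans (gcd[m,n]∣n (h zero) _) (gcdFin-∣ n (h ∘ suc) i)

gcdFin-greatest : ∀ n (h : Fin n → ℕ) {d} → (∀ i → d ∣ℕ h i) → d ∣ℕ gcdFin n h
gcdFin-greatest zero    h {d} d∣h = d ℕ∣.∣0
gcdFin-greatest (suc n) h     d∣h = gcd-greatest (d∣h zero) (gcdFin-greatest n (h ∘ suc) (d∣h ∘ suc))

gcdFin-*ˡ : ∀ n a (h : Fin n → ℕ) → a ℕ.* gcdFin n h ≡ gcdFin n (λ i → a ℕ.* h i)
gcdFin-*ˡ zero    a h = ℕₚ.*-zeroʳ a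
gcdFin-*ˡ (suc n) a h =
  trans (c*gcd[m,n]≡gcd[cm,cn] a (h zero) _) (cong (gcd (a ℕ.* h zero)) (gcdFin-*ˡ n a (h ∘ suc)))

∣-*gcdFin : ∀ n (h : Fin n → ℕ) {d} a → (∀ i → d ∣ℕ a ℕ.* h i) → d ∣ℕ a ℕ.* gcdFin n h
∣-*gcdFin n h a d∣ah = subst (_ ∣ℕ_) (sym (gcdFin-*ˡ n a h)) (gcdFin-greatest n _ d∣ah)

-- Kernels and coupled columns

mulVec-cong : ∀ {m n} (M : Matrix m n) {u w} → u ≗ w → mulVec M u ≗ mulVec M w
mulVec-cong {n = n} M u≗w l = sumFin-cong n (λ i → cong (M l i *_) (u≗w i))

module _ {m n : ℕ} (A : Matrix m n) where

  vecMul-orthogonal : ∀ (v : Vecℤ m) {u} → InKer A u → sumFin n (λ k → vecMul v A k * u k) ≡ +0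
  vecMul-orthogonal v {u} Au≡0 = begin
    sumFin n (λ k → sumFin m (λ l → v l * A l k) * u k)
      ≡⟨ sumFin-cong n (λ k → sym (sumFin-*ʳ m (u k) _)) ⟩
    sumFin n (λ k → sumFin m (λ l → (v l * A l k) * u k))
      ≡⟨ sumFin-swap n m _ ⟩
    sumFin m (λ l → sumFin n (λ k → (v l * A l k) * u k))
      ≡⟨ sumFin-cong m (λ l → trans (sumFin-cong n (λ k → *-assoc (v l) (A l k) (u k)))
                                    (sumFin-*ˡ n (v l) _)) ⟩
    sumFin m (λ l → v l * mulVec A u l)
      ≡⟨ sumFin-zero m (λ l → trans (cong (v l *_) (Au≡0 l)) (*-zeroʳ (v l))) ⟩
    +0 ∎

  -- Unlike u i * w j ≡ u j * w i, this is transitive, so it passes from adjacency to bouquets.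
  Coupled : Fin n → Fin n → Set
  Coupled i j = ∃₂ λ a b → a ≢ +0 × b ≢ +0 × (∀ u → InKer A u → a * u i ≡ b * u j)

  coupled-isEquivalence : IsEquivalence Coupled
  coupled-isEquivalence = record
    { refl  = + 1 , + 1 , (λ ()) , (λ ()) , (λ _ _ → refl)
    ; sym   = λ (a , b , a≢0 , b≢0 , eq) → b , a , b≢0 , a≢0 , (λ u Au≡0 → sym (eq u Au≡0))
    ; trans = λ (a , b , a≢0 , b≢0 , eq) (a′ , b′ , a′≢0 , b′≢0 , eq′) →
        a * a′ , b * b′ , *-≢0 a≢0 a′≢0 , *-≢0 b≢0 b′≢0 ,
        (λ u Au≡0 → chain a a′ b b′ (eq u Au≡0) (eq′ u Au≡0))
    }
    where
    chain : ∀ a a′ b b′ {x y z} → a * x ≡ b * y → a′ * y ≡ b′ * z → (a * a′) * x ≡ (b * b′) * z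
    chain a a′ b b′ {x} {y} {z} ax≡by a′y≡b′z = begin
      (a * a′) * x ≡⟨ swap₁ a a′ x ⟩
      a′ * (a * x) ≡⟨ cong (a′ *_) ax≡by ⟩
      a′ * (b * y) ≡⟨ swap₂ a′ b y ⟩
      b * (a′ * y) ≡⟨ cong (b *_) a′y≡b′z ⟩
      b * (b′ * z) ≡⟨ *-assoc b b′ z ⟨
      (b * b′) * z ∎
      where
      swap₁ : ∀ a a′ x → (a * a′) * x ≡ a′ * (a * x)
      swap₁ = solve-∀
      swap₂ : ∀ a′ b y → a′ * (b * y) ≡ b * (a′ * y)
      swap₂ = solve-∀

  -- With f = v · A supported on {i, j}, orthogonality gives f i u i + f j u j = 0.
  adjacent⇒coupled : ∀ {i j} → Adjacent A i j → Coupled i j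
  adjacent⇒coupled {i} {j} (i≢j , v , supp⇔) =
    f i , - f j , f≢0 (inj₁ refl) , f≢0 (inj₂ refl) ∘ -0⇒0 , coupling
    where
    f : Fin n → ℤ
    f = vecMul v A
    f≢0 : ∀ {k} → k ≡ i ⊎ k ≡ j → f k ≢ +0
    f≢0 = Equivalence.from (supp⇔ _)
    f≡0 : ∀ k → k ≢ i → k ≢ j → f k ≡ +0
    f≡0 k k≢i k≢j = decidable-stable (f k ℤ.≟ +0) λ fk≢0 →
      [ k≢i , k≢j ]′ (Equivalence.to (supp⇔ k) fk≢0)
    -0⇒0 : ∀ {x} → - x ≡ +0 → x ≡ +0
    -0⇒0 {x} -x≡0 = trans (sym (neg-involutive x)) (cong -_ -x≡0)
    coupling : ∀ u → InKer A u → f i * u i ≡ - f j * u j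
    coupling u Au≡0 = begin
      f i * u i                         ≡⟨ +-identityʳ _ ⟨
      f i * u i + +0                    ≡⟨ cong (_+_ (f i * u i)) (+-inverseʳ (f j * u j)) ⟨
      f i * u i + (f j * u j - f j * u j) ≡⟨ +-assoc (f i * u i) _ _ ⟨
      (f i * u i + f j * u j) - f j * u j ≡⟨ cong (_- f j * u j) pair≡0 ⟩
      +0 - f j * u j                    ≡⟨ +-identityˡ _ ⟩
      - (f j * u j)                     ≡⟨ neg-distribˡ-* (f j) (u j) ⟩
      - f j * u j                       ∎
      where
      pair≡0 : f i * u i + f j * u j ≡ +0
      pair≡0 = trans (sym (sumFin-pair n (λ k → f k * u k) i j i≢j
                             (λ k k≢i k≢j → cong (_* u k) (f≡0 k k≢i k≢j))))
                     (vecMul-orthogonal v Au≡0)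

  sameBouquet⇒coupled : ∀ {i j} → SameBouquet A i j → Coupled i j
  sameBouquet⇒coupled = fold coupled-isEquivalence adjacent⇒coupled

  coupled⇒cross : ∀ {i j} → Coupled i j → ∀ {u w} → InKer A u → InKer A w →
                  u i * w j ≡ u j * w i
  coupled⇒cross {i} {j} (a , b , a≢0 , b≢0 , eq) {u} {w} Au≡0 Aw≡0 =
    *-cancelʳ-≢0 (*-≢0 a≢0 b≢0) (begin
      (u i * w j) * (a * b) ≡⟨ regroup₁ a b (u i) (w j) ⟩
      (a * u i) * (b * w j) ≡⟨ cong₂ _*_ (eq u Au≡0) (sym (eq w Aw≡0)) ⟩
      (b * u j) * (a * w i) ≡⟨ regroup₂ a b (u j) (w i) ⟩
      (u j * w i) * (a * b) ∎)
    where
    regroup₁ : ∀ a b x y → (x * y) * (a * b) ≡ (a * x) * (b * y)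
    regroup₁ = solve-∀
    regroup₂ : ∀ a b x y → (b * x) * (a * y) ≡ (x * y) * (a * b)
    regroup₂ = solve-∀

  sameBouquet⇒cross : ∀ {i j} → SameBouquet A i j → ∀ {u w} → InKer A u → InKer A w →
                      u i * w j ≡ u j * w i
  sameBouquet⇒cross = coupled⇒cross ∘ sameBouquet⇒coupled

-- Move sequences read at sample coordinates

module Sampling {n q : ℕ} (s : Fin q → Fin n) (d : Fin q → ℤ) (d>0 : ∀ k → +0 < d k) where

  sample : Vecℤ n → Vecℤ q
  sample v k = v (s k) divℤ d k

  Divisible : Vecℤ n → Set
  Divisible v = ∀ k → d k ∣ v (s k)

  d≢0 : ∀ k → d k ≢ +0
  d≢0 k = <⇒≢ (d>0 k) ∘ sym

  sample-exact : ∀ {v} → Divisible v → ∀ k → sample v k * d k ≡ v (s k)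
  sample-exact d∣v k = divℤ-exact (d≢0 k) (d∣v k)

  sample-cong : ∀ {v w} → v ≗ w → sample v ≗ sample w
  sample-cong v≗w k = cong (_divℤ d k) (v≗w (s k))

  sample-neg : ∀ {v} → Divisible v → sample (negV v) ≗ negV (sample v)
  sample-neg {v} d∣v k = begin
    (- v (s k)) divℤ d k                ≡⟨ cong (λ x → (- x) divℤ d k) (sample-exact {v} d∣v k) ⟨
    (- (sample v k * d k)) divℤ d k     ≡⟨ cong (_divℤ d k) (neg-distribˡ-* (sample v k) (d k)) ⟩
    ((- sample v k) * d k) divℤ d k     ≡⟨ divℤ-cancel (- sample v k) (d≢0 k) ⟩
    - sample v k                        ∎

  divisible-cong : ∀ {v w} → v ≗ w → Divisible w → Divisible v
  divisible-cong v≗w d∣w k = subst (d k ∣_) (sym (v≗w (s k))) (d∣w k)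

  divisible-neg : ∀ {v} → Divisible (negV v) → Divisible v
  divisible-neg {v} d∣-v k = subst (∣ d k ∣ ∣ℕ_) (∣-i∣≡∣i∣ (v (s k))) (d∣-v k)

  ∈±-divisible : ∀ {L v} → All Divisible L → v ∈± L → Divisible v
  ∈±-divisible d∣L (inj₁ v∈L)  = All.lookupWith (λ d∣x v≗x → divisible-cong v≗x d∣x) d∣L v∈L
  ∈±-divisible {v = v} d∣L (inj₂ -v∈L) =
    divisible-neg {v} (All.lookupWith (λ d∣x -v≗x → divisible-cong -v≗x d∣x) d∣L -v∈L)

  ∈±-sample : ∀ {L v} → All Divisible L → v ∈± L → sample v ∈± map sample L
  ∈±-sample d∣L (inj₁ v∈L)  = inj₁ (Anyₚ.map⁺ (Any.map sample-cong v∈L))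
  ∈±-sample {v = v} d∣L v∈±L@(inj₂ -v∈L) = inj₂ (Anyₚ.map⁺ (Any.map
    (λ -v≗x k → trans (sym (sample-neg {v} (∈±-divisible d∣L v∈±L) k)) (sample-cong -v≗x k)) -v∈L))

  moves-sample : ∀ {L X Y x u} → All Divisible L → Moves L X Y →
                 (∀ k → X (s k) ≡ x k * d k) → (∀ k → Y (s k) ≡ u k * d k) →
                 Moves (map sample L) x u
  moves-sample d∣L (done X≗Y) X≡ Y≡ =
    done λ k → *-cancelʳ-≢0 (d≢0 k) (trans (sym (X≡ k)) (trans (X≗Y (s k)) (Y≡ k)))
  moves-sample {X = X} {x = x} d∣L (step v v∈±L X-v≥0 rest) X≡ Y≡ =
    step (sample v) (∈±-sample d∣L v∈±L)
         (λ k → nonNeg-cancelʳ (d>0 k) (subst (+0 ≤_) (X-v≡ k) (X-v≥0 (s k))))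
         (moves-sample d∣L rest X-v≡ Y≡)
    where
    X-v≡ : ∀ k → X (s k) - v (s k) ≡ (x k - sample v k) * d k
    X-v≡ k = begin
      X (s k) - v (s k)               ≡⟨ cong₂ _-_ (X≡ k) (sym (sample-exact {v} (∈±-divisible d∣L v∈±L) k)) ⟩
      x k * d k - sample v k * d k    ≡⟨ *-distribʳ-- (x k) (sample v k) (d k) ⟩
      (x k - sample v k) * d k        ∎
      where
      *-distribʳ-- : ∀ a b e → a * e - b * e ≡ (a - b) * e
      *-distribʳ-- = solve-∀

-- The bouquet matrix

if-yes : ∀ {P X : Set} (P? : Dec P) {x y : X} → P → (if ⌊ P? ⌋ then x else y) ≡ x
if-yes (yes _) _ = refl
if-yes (no ¬p) p = contradiction p ¬p

if-no : ∀ {P X : Set} (P? : Dec P) {x y : X} → ¬ P → (if ⌊ P? ⌋ then x else y) ≡ y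
if-no (yes p) ¬p = contradiction p ¬p
if-no (no _)  _  = refl

module BouquetMatrix {m n r : ℕ} {A : Matrix m n} {K : Matrix n r}
                     (K-basis : IsKernelBasis A K) (bd : BouquetData A K) where
  open BouquetData bd

  free? : ∀ k → Dec (Free k)
  free? k = Finₚ.all? λ i → (β i Fin.≟ k) →-dec Finₚ.all? λ j → K i j ℤ.≟ +0

  c-outside : ∀ {k i} → β i ≢ k → c k i ≡ +0
  c-outside {k} {i} i∉k with free? k
  ... | yes free = decidable-stable (c k i ℤ.≟ +0) (i∉k ∘ Equivalence.to (proj₁ (c-free k free) i))
  ... | no nonfree with c-nonfree k nonfree
  ...   | _ , _ , _ , _ , _ , c-def = trans (c-def i) (if-no (β i Fin.≟ k) i∉k)

  β-jk : ∀ k → β (jk k) ≡ k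
  β-jk k = decidable-stable (β (jk k) Fin.≟ k) (jk-supp k ∘ c-outside)

  jk-unique : ∀ {k i} → c k i ≢ +0 → (∀ j → toℕ j ℕ.< toℕ i → c k j ≡ +0) → jk k ≡ i
  jk-unique {k} {i} cki≢0 c≡0-below with Finₚ.<-cmp (jk k) i
  ... | tri< jk<i _ _ = contradiction (c≡0-below (jk k) jk<i) (jk-supp k)
  ... | tri≈ _ jk≡i _ = jk≡i
  ... | tri> _ _ i<jk = contradiction (jk-min k i i<jk) cki≢0

  lead : Fin q → ℤ
  lead k = c k (jk k)

  free-kernel-zero : ∀ {k} → Free k → ∀ {v} → InKer A v → ∀ {i} → InB k i → v i ≡ +0
  free-kernel-zero free {v} Av≡0 {i} i∈k with proj₁ (proj₂ K-basis) v Av≡0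
  ... | l , v≗Kl = trans (v≗Kl i)
                         (sumFin-zero r λ j → trans (cong (_* l j) (free i i∈k j)) (*-zeroˡ (l j)))

  FirstPositive : Fin q → Fin n → Set
  FirstPositive k i = +0 < c k i × (∀ j → toℕ j ℕ.< toℕ i → c k j ≡ +0)

  bouquetColumn : Fin q → Fin r → Fin n → ℕ
  bouquetColumn k p i = if ⌊ β i Fin.≟ k ⌋ then ∣ K i p ∣ else 0

  -- p is the Gale coordinate called j in the definition of c_B.
  module NonFree {k : Fin q} (p : Fin r) (K≢0 : ∀ i → InB k i → K i p ≢ +0)
                 (i₀ : Fin n) (i₀∈k : InB k i₀) (i₀-min : ∀ i → InB k i → toℕ i₀ ℕ.≤ toℕ i)
                 (c-def : ∀ i → c k i ≡ (if ⌊ β i Fin.≟ k ⌋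
                                         then (sgn (K i₀ p) * K i p) divℤ (+ gcdFin n (bouquetColumn k p))
                                         else +0)) where

    g : ℕ
    g = gcdFin n (bouquetColumn k p)

    ε : ℤ
    ε = sgn (K i₀ p)

    g∣K : ∀ {i} → InB k i → g ∣ℕ ∣ K i p ∣
    g∣K {i} i∈k = subst (g ∣ℕ_) (if-yes (β i Fin.≟ k) i∈k) (gcdFin-∣ n _ i)

    g≢0 : g ≢ 0
    g≢0 g≡0 = K≢0 i₀ i₀∈k (∣i∣≡0⇒i≡0 (ℕ∣.0∣⇒≡0 (subst (_∣ℕ ∣ K i₀ p ∣) g≡0 (g∣K i₀∈k))))

    +g≢0 : + g ≢ +0
    +g≢0 = g≢0 ∘ cong ∣_∣

    c-scaled : ∀ {i} → InB k i → c k i * + g ≡ ε * K i p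
    c-scaled {i} i∈k = begin
      c k i * + g                    ≡⟨ cong (_* + g) (trans (c-def i) (if-yes (β i Fin.≟ k) i∈k)) ⟩
      ((ε * K i p) divℤ (+ g)) * + g ≡⟨ divℤ-exact +g≢0 g∣εK ⟩
      ε * K i p                      ∎
      where
      g∣εK : + g ∣ ε * K i p
      g∣εK = subst (g ∣ℕ_) (sym (abs-* ε (K i p))) (ℕ∣.∣n⇒∣m*n ∣ ε ∣ (g∣K i∈k))

    ∣c∣*g : ∀ {i} → InB k i → ∣ c k i ∣ ℕ.* g ≡ ∣ K i p ∣
    ∣c∣*g {i} i∈k = begin
      ∣ c k i ∣ ℕ.* g      ≡⟨ abs-* (c k i) (+ g) ⟨
      ∣ c k i * + g ∣      ≡⟨ cong ∣_∣ (c-scaled i∈k) ⟩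
      ∣ ε * K i p ∣        ≡⟨ abs-* ε (K i p) ⟩
      ∣ ε ∣ ℕ.* ∣ K i p ∣  ≡⟨ cong (ℕ._* ∣ K i p ∣) (∣sgn∣≡1 (K≢0 i₀ i₀∈k)) ⟩
      1 ℕ.* ∣ K i p ∣      ≡⟨ ℕₚ.*-identityˡ _ ⟩
      ∣ K i p ∣            ∎

    -- ε is chosen so that c k i₀ * g = ε * K i₀ p = ∣ K i₀ p ∣ > 0.
    first-positive : ∃ (FirstPositive k)
    first-positive = i₀ , c-i₀>0 , λ j j<i₀ → c-outside λ j∈k → ℕₚ.<⇒≱ j<i₀ (i₀-min j j∈k)
      where
      c-i₀>0 : +0 < c k i₀
      c-i₀>0 = *-cancelʳ-<-nonNeg (+ g)
        (subst (+0 <_) (sym (trans (c-scaled i₀∈k) (sgn-*-self (K i₀ p))))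
               (ℤ.+<+ (ℕₚ.n≢0⇒n>0 (K≢0 i₀ i₀∈k ∘ ∣i∣≡0⇒i≡0))))

    module _ {v : Vecℤ n} (Av≡0 : InKer A v) where

      cross : ∀ {i} → InB k i → v i * K (jk k) p ≡ v (jk k) * K i p
      cross {i} i∈k =
        sameBouquet⇒cross A (Equivalence.to (β-cls i (jk k)) (trans i∈k (sym (β-jk k))))
                          Av≡0 (proj₁ K-basis p)

      proportional : ∀ {i} → InB k i → v i * lead k ≡ v (jk k) * c k i
      proportional {i} i∈k = *-cancelʳ-≢0 +g≢0 (begin
        (v i * lead k) * + g        ≡⟨ *-assoc (v i) (lead k) (+ g) ⟩
        v i * (lead k * + g)        ≡⟨ cong (v i *_) (c-scaled (β-jk k)) ⟩
        v i * (ε * K (jk k) p)      ≡⟨ move-ε (v i) ε (K (jk k) p) ⟩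
        ε * (v i * K (jk k) p)      ≡⟨ cong (ε *_) (cross i∈k) ⟩
        ε * (v (jk k) * K i p)      ≡⟨ move-ε (v (jk k)) ε (K i p) ⟨
        v (jk k) * (ε * K i p)      ≡⟨ cong (v (jk k) *_) (c-scaled i∈k) ⟨
        v (jk k) * (c k i * + g)    ≡⟨ *-assoc (v (jk k)) (c k i) (+ g) ⟨
        (v (jk k) * c k i) * + g    ∎)
        where
        move-ε : ∀ a e b → a * (e * b) ≡ e * (a * b)
        move-ε = solve-∀

      -- With j = jk k: ∣ K j p ∣ = ∣ lead k ∣ g divides ∣ v j ∣ ∣ K i p ∣ for every i of the
      -- bouquet, hence divides ∣ v j ∣ g.
      lead-∣ : lead k ∣ v (jk k)
      lead-∣ = ℕ∣.*-cancelʳ-∣ g {{ℕ.≢-nonZero g≢0}}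
                 (subst (_∣ℕ ∣ v (jk k) ∣ ℕ.* g) (sym (∣c∣*g (β-jk k)))
                   (∣-*gcdFin n (bouquetColumn k p) ∣ v (jk k) ∣ K∣v*column))
        where
        K∣v*column : ∀ i → ∣ K (jk k) p ∣ ∣ℕ ∣ v (jk k) ∣ ℕ.* bouquetColumn k p i
        K∣v*column i with β i Fin.≟ k
        ... | yes i∈k = divides ∣ v i ∣ (begin
              ∣ v (jk k) ∣ ℕ.* ∣ K i p ∣  ≡⟨ abs-* (v (jk k)) (K i p) ⟨
              ∣ v (jk k) * K i p ∣        ≡⟨ cong ∣_∣ (cross i∈k) ⟨
              ∣ v i * K (jk k) p ∣        ≡⟨ abs-* (v i) (K (jk k) p) ⟩
              ∣ v i ∣ ℕ.* ∣ K (jk k) p ∣  ∎)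
        ... | no _ = subst (∣ K (jk k) p ∣ ∣ℕ_) (sym (ℕₚ.*-zeroʳ ∣ v (jk k) ∣)) (∣ K (jk k) p ∣ ℕ∣.∣0)

  first-positive : ∀ k → ∃ (FirstPositive k)
  first-positive k with free? k
  ... | yes free = proj₂ (c-free k free)
  ... | no nonfree with c-nonfree k nonfree
  ...   | p , K≢0 , i₀ , i₀∈k , i₀-min , c-def = NonFree.first-positive p K≢0 i₀ i₀∈k i₀-min c-def

  lead-pos : ∀ k → +0 < lead k
  lead-pos k with first-positive k
  ... | i , c-i>0 , c≡0-below =
    subst (λ j → +0 < c k j) (sym (jk-unique (<⇒≢ c-i>0 ∘ sym) c≡0-below)) c-i>0

  proportional : ∀ {v} → InKer A v → ∀ {k i} → InB k i → v i * lead k ≡ v (jk k) * c k i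
  proportional {v} Av≡0 {k} {i} i∈k with free? k
  ... | yes free = begin
    v i * lead k     ≡⟨ cong (_* lead k) (free-kernel-zero free Av≡0 i∈k) ⟩
    +0               ≡⟨ cong (_* c k i) (free-kernel-zero free Av≡0 (β-jk k)) ⟨
    v (jk k) * c k i ∎
  ... | no nonfree with c-nonfree k nonfree
  ...   | p , K≢0 , i₀ , i₀∈k , i₀-min , c-def =
    NonFree.proportional p K≢0 i₀ i₀∈k i₀-min c-def Av≡0 i∈k

  lead-∣ : ∀ {v} → InKer A v → ∀ k → lead k ∣ v (jk k)
  lead-∣ {v} Av≡0 k with free? k
  ... | yes free = subst (∣ lead k ∣ ∣ℕ_) (cong ∣_∣ (sym (free-kernel-zero free Av≡0 (β-jk k))))
                         (∣ lead k ∣ ℕ∣.∣0)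
  ... | no nonfree with c-nonfree k nonfree
  ...   | p , K≢0 , i₀ , i₀∈k , i₀-min , c-def = NonFree.lead-∣ p K≢0 i₀ i₀∈k i₀-min c-def Av≡0

  kernel-on-bouquet : ∀ {v} → InKer A v → ∀ {k i} → InB k i → v i ≡ T v k * c k i
  kernel-on-bouquet {v} Av≡0 {k} {i} i∈k = *-cancelʳ-≢0 (jk-supp k) (begin
    v i * lead k             ≡⟨ proportional Av≡0 i∈k ⟩
    v (jk k) * c k i         ≡⟨ cong (_* c k i) (divℤ-exact (jk-supp k) (lead-∣ Av≡0 k)) ⟨
    (T v k * lead k) * c k i ≡⟨ swap₂₃ (T v k) (lead k) (c k i) ⟩
    (T v k * c k i) * lead k ∎)
    where
    swap₂₃ : ∀ a b e → (a * b) * e ≡ (a * e) * b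
    swap₂₃ = solve-∀

  D : Vecℤ q → Vecℤ n
  D y i = sumFin q (λ k → y k * c k i)

  D-single : ∀ y i → D y i ≡ y (β i) * c (β i) i
  D-single y i = sumFin-single q _ (β i)
    (λ k k≢βi → trans (cong (y k *_) (c-outside (k≢βi ∘ sym))) (*-zeroʳ (y k)))

  D∘T-kernel : ∀ {v} → InKer A v → D (T v) ≗ v
  D∘T-kernel {v} Av≡0 i = trans (D-single (T v) i) (sym (kernel-on-bouquet Av≡0 refl))

  mulVec-A_B : ∀ y → mulVec A_B y ≗ mulVec A (D y)
  mulVec-A_B y l = begin
    sumFin q (λ k → sumFin n (λ i → c k i * A l i) * y k)
      ≡⟨ sumFin-cong q (λ k → sym (sumFin-*ʳ n (y k) _)) ⟩
    sumFin q (λ k → sumFin n (λ i → (c k i * A l i) * y k))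
      ≡⟨ sumFin-swap q n _ ⟩
    sumFin n (λ i → sumFin q (λ k → (c k i * A l i) * y k))
      ≡⟨ sumFin-cong n (λ i → trans (sumFin-cong q (λ k → regroup (c k i) (A l i) (y k)))
                                    (sumFin-*ˡ q (A l i) _)) ⟩
    sumFin n (λ i → A l i * D y i) ∎
    where
    regroup : ∀ a b e → (a * b) * e ≡ b * (e * a)
    regroup = solve-∀

  T-kernel : ∀ {v} → InKer A v → InKer A_B (T v)
  T-kernel Av≡0 l = trans (mulVec-A_B _ l) (trans (mulVec-cong A (D∘T-kernel Av≡0) l) (Av≡0 l))

  lift : Vecℤ q → Vecℤ q → Vecℤ n
  lift w u i = splitScale (c (β i) i) (w (β i)) (u (β i))

  lift-nonNeg : ∀ {w u} → NonNeg w → NonNeg u → NonNeg (lift w u)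
  lift-nonNeg w≥0 u≥0 i = splitScale-nonNeg (c (β i) i) (w≥0 (β i)) (u≥0 (β i))

  lift-sub : ∀ w u → subV (lift w u) (lift u w) ≗ D (subV w u)
  lift-sub w u i = trans (splitScale-sub (c (β i) i) _ _) (sym (D-single (subV w u) i))

  lift-kernel : ∀ {w u} → InKer A_B (subV w u) → InKer A (subV (lift w u) (lift u w))
  lift-kernel {w} {u} A_B[w-u]≡0 l =
    trans (mulVec-cong A (lift-sub w u) l) (trans (sym (mulVec-A_B (subV w u) l)) (A_B[w-u]≡0 l))

  lift-jk : ∀ w u k → lift w u (jk k) ≡ w k * lead k
  lift-jk w u k = trans (cong (λ k′ → splitScale (c k′ (jk k)) (w k′) (u k′)) (β-jk k))
                        (splitScale-pos (w k) (u k) (lead-pos k))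

  markovBasis-A_B : ∀ {L} → MarkovBasis A L → MarkovBasis A_B (map T L)
  markovBasis-A_B (L⊆ker , connected) =
    Allₚ.map⁺ (All.map T-kernel L⊆ker) ,
    λ w u w≥0 u≥0 A_B[w-u]≡0 →
      moves-sample (All.map lead-∣ L⊆ker)
        (connected (lift w u) (lift u w) (lift-nonNeg w≥0 u≥0) (lift-nonNeg u≥0 w≥0)
                   (lift-kernel {w} {u} A_B[w-u]≡0))
        (lift-jk w u) (lift-jk u w)
    where open Sampling jk lead lead-pos

theorem3p1 : ∀ {m n r : ℕ} (A : Matrix m n) (K : Matrix n r) →
    IsKernelBasis A K → (bd : BouquetData A K) → (L : List (Vecℤ n)) →
    MinimalMarkovBasis A L →
    MarkovBasis (BouquetData.A_B bd) (map (BouquetData.T bd) L)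
theorem3p1 A K K-basis bd L (markovBasis , _) = BouquetMatrix.markovBasis-A_B K-basis bd markovBasis
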